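{- Let $G$ be a connected graph with minimum degree $\delta(G)\ge 3$ and let $D$ be a connected $3$-dominating set of $G$. Then $px_3(G)\le px_3(G[D])+1$. Moreover, the bound is tight: there exist such $G$ and $D$ with $px_3(G)=px_3(G[D])+1$.
   Context: All graphs are finite, simple and undirected. In an edge-colored graph (adjacent edges may receive the same color), a tree is proper if no two adjacent edges of it receive the same color. For a connected graph $G$ and $S\subseteq V(G)$, an $S$-tree is a tree in $G$ containing all vertices of $S$. An edge-coloring of $G$ is a $3$-proper coloring if for every $3$-subset $S$ of $V(G)$ there is a proper $S$-tree in $G$; $px_3(G)$ is the minimum number of colors in a $3$-proper coloring of $G$. For $D\subseteq V(G)$, $G[D]$ is the induced subgraph. $D$ is a connected $3$-dominating set if every vertex of $V(G)\setminus D$ is adjacent to at least $3$ distinct vertices of $D$ and $G[D]$ is connected. -}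

module Defs where

open import Data.Bool using (Bool; true; false; T)
open import Data.Nat using (ℕ; zero; suc; _<_)
open import Data.Fin using (Fin; zero; suc; inject₁; fromℕ)
open import Data.Product using (Σ; Σ-syntax; ∃; ∃-syntax; _×_; _,_; proj₁)
open import Relation.Binary.PropositionalEquality using (_≡_; _≢_)
open import Relation.Nullary using (¬_)
open import Function.Definitions using (Injective)

record Graph (V : Set) : Set where
  field
    adj     : V → V → Bool
    adj-sym : ∀ u v → adj u v ≡ adj v u
    loopless : ∀ v → adj v v ≡ false
open Graph public

data Walk {V : Set} (E : V → V → Bool) : V → V → Set where
  here : ∀ {v} → Walk E v v
  step : ∀ {u w v} → T (E u w) → Walk E w v → Walk E u v

-- a cycle in the edge relation E: distinct vertices c 0, …, c (m+2) (at least 3)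
-- with consecutive vertices adjacent and the last adjacent to the first
Cycle : {V : Set} → (V → V → Bool) → Set
Cycle {V} E = Σ[ m ∈ ℕ ] Σ[ c ∈ (Fin (suc (suc (suc m))) → V) ]
  ( Injective _≡_ _≡_ c
  × (∀ (i : Fin (suc (suc m))) → T (E (c (inject₁ i)) (c (suc i))))
  × T (E (c (fromℕ (suc (suc m)))) (c zero)) )

Connected : {V : Set} → Graph V → Set
Connected {V} G = ∀ (u v : V) → Walk (adj G) u v

MinDeg≥3 : {V : Set} → Graph V → Set
MinDeg≥3 {V} G = ∀ (v : V) → Σ[ a ∈ V ] Σ[ b ∈ V ] Σ[ c ∈ V ]
  (a ≢ b × a ≢ c × b ≢ c × T (adj G v a) × T (adj G v b) × T (adj G v c))

Induced : {V : Set} → Graph V → (D : V → Bool) → Graph (Σ V (λ v → T (D v)))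
Induced G D = record
  { adj = λ u v → adj G (proj₁ u) (proj₁ v)
  ; adj-sym = λ u v → adj-sym G (proj₁ u) (proj₁ v)
  ; loopless = λ v → loopless G (proj₁ v) }

Connected3Dominating : {V : Set} → Graph V → (V → Bool) → Set
Connected3Dominating {V} G D =
  (∀ (v : V) → D v ≡ false → Σ[ a ∈ V ] Σ[ b ∈ V ] Σ[ c ∈ V ]
     (a ≢ b × a ≢ c × b ≢ c × T (D a) × T (D b) × T (D c)
      × T (adj G v a) × T (adj G v b) × T (adj G v c)))
  × Connected (Induced G D)

-- an edge-colouring with k colours (adjacent edges may share colours);
-- only edges are coloured, and the colour of an edge does not depend on orientation
record Colouring {V : Set} (G : Graph V) (k : ℕ) : Set where
  field
    col     : (u v : V) → T (adj G u v) → Fin k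
    col-sym : ∀ u v (p : T (adj G u v)) (q : T (adj G v u)) → col u v p ≡ col v u q
open Colouring public

record Tree {V : Set} (G : Graph V) : Set where
  field
    inV    : V → Bool
    inE    : V → V → Bool
    inE-sym : ∀ u v → inE u v ≡ inE v u
    inE-adj : ∀ u v → T (inE u v) → T (adj G u v)
    inE-inV : ∀ u v → T (inE u v) → T (inV u)
    connected : ∀ u v → T (inV u) → T (inV v) → Walk inE u v
    acyclic : ¬ Cycle inE
open Tree public

Proper : {V : Set} {G : Graph V} {k : ℕ} → Colouring G k → Tree G → Set
Proper {V} {G} c t = ∀ (u v w : V) (e₁ : T (inE t u v)) (e₂ : T (inE t v w)) → u ≢ w →
  col c u v (inE-adj t u v e₁) ≢ col c v w (inE-adj t v w e₂)

ThreeProper : {V : Set} {G : Graph V} {k : ℕ} → Colouring G k → Set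
ThreeProper {V} {G} c = ∀ (x y z : V) → x ≢ y → x ≢ z → y ≢ z →
  Σ[ t ∈ Tree G ] (T (inV t x) × T (inV t y) × T (inV t z) × Proper c t)

IsPx3 : {V : Set} → Graph V → ℕ → Set
IsPx3 G k = (Σ[ c ∈ Colouring G k ] ThreeProper c)
          × (∀ m → m < k → ¬ (Σ[ c ∈ Colouring G m ] ThreeProper c))

module Submission where

-- Colour the edges of G[D] by a 3-proper colouring of G[D] and every other edge by one new colour.
-- Given three vertices, replace each vertex outside D by a D-neighbour; since such a vertex has three
-- neighbours in D, the representatives can be chosen pairwise distinct and distinct from the other two
-- given vertices. A proper tree of G[D] through the representatives, extended by the at most three
-- pendant edges, is proper: the pendant edges are pairwise disjoint and the new colour is used nowhere else.
-- For tightness take D a triangle joined to 17 independent outer vertices. Then px₃(G[D]) = 2, and a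
-- 2-colouring of G gives three outer vertices with the same colour pattern towards the triangle. In a
-- proper tree through them each is a leaf, yet a properly 2-coloured tree has maximum degree 2, so it is
-- a path and has only two leaves.

open import Data.Bool using (Bool; true; false; T; _∨_; _∧_; not; if_then_else_)
open import Data.Bool.Properties using (T-irrelevant; T-∨; T-∧; ∨-comm; ∧-comm; ∧-zeroʳ)
open import Data.Empty using (⊥; ⊥-elim)
open import Data.Fin using (Fin; zero; suc; inject₁; fromℕ; inject≤; _↑ˡ_; _↑ʳ_)
open import Data.Fin.Properties
  using (_≟_; pigeonhole; suc-injective; any?; inject≤-injective; inject₁-injective; fromℕ≢inject₁)
open import Data.Fin.Relation.Unary.Top using (view; ‵fromℕ; ‵inj₁)
open import Data.List using (List; []; _∷_; length; filter)
open import Data.List.Relation.Unary.All using (All; []; _∷_)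
open import Data.List.Relation.Unary.All.Properties using (all-filter; filter⁺)
open import Data.List.Relation.Unary.Unique.Propositional using (Unique; []; _∷_)
open import Data.List.Relation.Unary.Unique.Propositional.Properties
  using (allFin⁺) renaming (filter⁺ to filter⁺ᵁ)
open import Data.Maybe using (Maybe; just; nothing)
open import Data.Nat using (ℕ; zero; suc; _+_; _≤_; z≤n; s≤s; s≤s⁻¹; _≤?_)
open import Data.Nat.Properties using (≰⇒>; ≤-refl; +-suc; +-cancelˡ-≤; +-monoˡ-≤; module ≤-Reasoning)
open import Data.Product using (Σ; Σ-syntax; _×_; _,_; proj₁; proj₂)
open import Data.Product.Properties using (≡-dec)
open import Data.Sum using (_⊎_; inj₁; inj₂; [_,_])
open import Data.Unit using (⊤; tt)
open import Data.Vec using ([]; _∷_; lookup)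
open import Function using (_∘_; id)
open import Function.Bundles using (module Equivalence)
open import Function.Definitions using (Injective)
open import Level using (0ℓ)
open import Relation.Binary.Definitions using (DecidableEquality)
open import Relation.Binary.PropositionalEquality
  using (_≡_; _≢_; refl; sym; trans; cong; cong₂; subst; ≡-≟-identity)
open import Relation.Nullary using (¬_; yes; no)
open import Relation.Nullary.Decidable using (⌊_⌋; toWitness; fromWitness; T?)
open import Relation.Unary using (Pred; _∈_; _∉_; _⊆_; _∪_; ∅; ｛_｝)

open import Defs

open Equivalence using (to; from)

private
  variable
    V W : Set
    k : ℕ

_◅◅_ : {E : V → V → Bool} {u v w : V} → Walk E u v → Walk E v w → Walk E u w
here ◅◅ q = q
step e p ◅◅ q = step e (p ◅◅ q)

mapWalk : {E : V → V → Bool} {F : W → W → Bool} (f : V → W) →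
  (∀ {u v} → T (E u v) → T (F (f u) (f v))) → ∀ {u v} → Walk E u v → Walk F (f u) (f v)
mapWalk f h here = here
mapWalk f h (step e p) = step (h e) (mapWalk f h p)

col-irr : {G : Graph V} (c : Colouring G k) {u v : V} (p q : T (adj G u v)) → col c u v p ≡ col c u v q
col-irr c p q = cong (col c _ _) (T-irrelevant p q)

SymmetricEdges : (V → V → Bool) → Set
SymmetricEdges {V} E = ∀ {u v : V} → T (E u v) → T (E v u)

cycle-vertex-has-two-neighbours : {E : V → V → Bool} → SymmetricEdges E → ((m , c , _) : Cycle E) →
  ∀ i → Σ[ a ∈ V ] Σ[ b ∈ V ] (a ≢ b × T (E (c i) a) × T (E (c i) b))
cycle-vertex-has-two-neighbours E-sym (m , c , inj , edge , closing) zero =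
  c (suc zero) , c (fromℕ (suc (suc m))) , (λ ()) ∘ inj , edge zero , E-sym closing
cycle-vertex-has-two-neighbours E-sym (m , c , inj , edge , closing) (suc j) with view j
... | ‵fromℕ = c (inject₁ (fromℕ (suc m))) , c zero , (λ ()) ∘ inj , E-sym (edge (fromℕ (suc m))) , closing
... | ‵inj₁ {i = j′} _ = c (inject₁ (inject₁ j′)) , c (suc (suc j′)) , inject₁²≢suc² j′ ∘ inj ,
        E-sym (edge (inject₁ j′)) , edge (suc j′)
  where
  inject₁²≢suc² : ∀ {n} (i : Fin n) → inject₁ (inject₁ i) ≢ suc (suc i)
  inject₁²≢suc² zero ()
  inject₁²≢suc² (suc i) eq = inject₁²≢suc² i (suc-injective eq)

≢⇒T-not : (_≟_ : DecidableEquality V) {u v : V} → u ≢ v → T (not ⌊ u ≟ v ⌋)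
≢⇒T-not _≟_ {u} {v} u≢v with u ≟ v
... | yes u≡v = u≢v u≡v
... | no  _   = _

≟-sym : (_≟_ : DecidableEquality V) (u v : V) → ⌊ u ≟ v ⌋ ≡ ⌊ v ≟ u ⌋
≟-sym _≟_ u v with u ≟ v | v ≟ u
... | yes _   | yes _   = refl
... | yes u≡v | no  v≢u = ⊥-elim (v≢u (sym u≡v))
... | no  u≢v | yes v≡u = ⊥-elim (u≢v (sym v≡u))
... | no  _   | no  _   = refl

connected-via-hub : DecidableEquality V → {G : Graph V} (r : V) → (∀ {v} → r ≢ v → T (adj G r v)) → Connected G
connected-via-hub _≟_ {G} r hub u v = to-hub u ◅◅ from-hub v
  where
  from-hub : ∀ v → Walk (adj G) r v
  from-hub v with r ≟ v
  ... | yes refl = here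
  ... | no  r≢v  = step (hub r≢v) here
  to-hub : ∀ u → Walk (adj G) u r
  to-hub u with r ≟ u
  ... | yes refl = here
  ... | no  r≢u  = step (subst T (adj-sym G r u) (hub r≢u)) here

-- Trees

module Pendant {G : Graph V} (_≟_ : DecidableEquality V) (t : Tree G) {s p : V}
  (sp : T (adj G s p)) (p∈t : T (inV t p)) (s∉t : ¬ T (inV t s)) where

  pendant : V → V → Bool
  pendant u v = (⌊ u ≟ s ⌋ ∧ ⌊ v ≟ p ⌋) ∨ (⌊ u ≟ p ⌋ ∧ ⌊ v ≟ s ⌋)

  edges : V → V → Bool
  edges u v = inE t u v ∨ pendant u v

  vertices : V → Bool
  vertices u = inV t u ∨ ⌊ u ≟ s ⌋

  data EdgeView : V → V → Set where
    old : ∀ {u v} → T (inE t u v) → EdgeView u v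
    s-p : EdgeView s p
    p-s : EdgeView p s

  edge-view : ∀ {u v} → T (edges u v) → EdgeView u v
  edge-view {u} {v} e with to (T-∨ {inE t u v}) e
  ... | inj₁ e′ = old e′
  ... | inj₂ e′ with to (T-∨ {⌊ u ≟ s ⌋ ∧ ⌊ v ≟ p ⌋}) e′
  ...   | inj₁ uv with to (T-∧ {⌊ u ≟ s ⌋}) uv
  ...     | u≡s , v≡p with toWitness u≡s | toWitness v≡p
  ...       | refl | refl = s-p
  edge-view {u} {v} e | inj₂ e′ | inj₂ uv with to (T-∧ {⌊ u ≟ p ⌋}) uv
  ...     | u≡p , v≡s with toWitness u≡p | toWitness v≡s
  ...       | refl | refl = p-s

  view-edge : ∀ {u v} → EdgeView u v → T (edges u v)
  view-edge {u} {v} (old e) = from (T-∨ {inE t u v}) (inj₁ e)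
  view-edge s-p = from (T-∨ {inE t s p}) (inj₂ (from (T-∨ {⌊ s ≟ s ⌋ ∧ ⌊ p ≟ p ⌋})
    (inj₁ (from (T-∧ {⌊ s ≟ s ⌋}) (fromWitness refl , fromWitness refl)))))
  view-edge p-s = from (T-∨ {inE t p s}) (inj₂ (from (T-∨ {⌊ p ≟ s ⌋ ∧ ⌊ s ≟ p ⌋})
    (inj₂ (from (T-∧ {⌊ p ≟ p ⌋}) (fromWitness refl , fromWitness refl)))))

  s≢p : s ≢ p
  s≢p refl = s∉t p∈t

  edges-sym : ∀ u v → edges u v ≡ edges v u
  edges-sym u v = cong₂ _∨_ (inE-sym t u v)
    (trans (cong₂ _∨_ (∧-comm ⌊ u ≟ s ⌋ ⌊ v ≟ p ⌋) (∧-comm ⌊ u ≟ p ⌋ ⌊ v ≟ s ⌋))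
           (∨-comm (⌊ v ≟ p ⌋ ∧ ⌊ u ≟ s ⌋) (⌊ v ≟ s ⌋ ∧ ⌊ u ≟ p ⌋)))

  edges-adj : ∀ u v → T (edges u v) → T (adj G u v)
  edges-adj u v e with edge-view e
  ... | old e′ = inE-adj t u v e′
  ... | s-p = sp
  ... | p-s = subst T (adj-sym G s p) sp

  s∈ : T (vertices s)
  s∈ = from (T-∨ {inV t s}) (inj₂ (fromWitness refl))

  old∈ : ∀ {u} → T (inV t u) → T (vertices u)
  old∈ {u} = from (T-∨ {inV t u}) ∘ inj₁

  edges-vertices : ∀ u v → T (edges u v) → T (vertices u)
  edges-vertices u v e with edge-view e
  ... | old e′ = old∈ (inE-inV t u v e′)
  ... | s-p = s∈
  ... | p-s = old∈ p∈t

  oldWalk : ∀ {u v} → Walk (inE t) u v → Walk edges u v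
  oldWalk = mapWalk id (view-edge ∘ old)

  data VertexView : V → Set where
    old : ∀ {u} → T (inV t u) → VertexView u
    new : VertexView s

  vertex-view : ∀ {u} → T (vertices u) → VertexView u
  vertex-view {u} u∈ with to (T-∨ {inV t u}) u∈
  ... | inj₁ u∈t = old u∈t
  ... | inj₂ u≡s with toWitness u≡s
  ...   | refl = new

  connected′ : ∀ u v → T (vertices u) → T (vertices v) → Walk edges u v
  connected′ u v u∈ v∈ with vertex-view u∈ | vertex-view v∈
  ... | old u∈t | old v∈t = oldWalk (connected t u v u∈t v∈t)
  ... | old u∈t | new = oldWalk (connected t u p u∈t p∈t) ◅◅ step (view-edge p-s) here
  ... | new | old v∈t = step (view-edge s-p) (oldWalk (connected t p v p∈t v∈t))
  ... | new | new = here

  only-neighbour-of-s : ∀ {w} → T (edges s w) → w ≡ p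
  only-neighbour-of-s e with edge-view e
  ... | old e′ = ⊥-elim (s∉t (inE-inV t _ _ e′))
  ... | s-p = refl
  ... | p-s = ⊥-elim (s∉t p∈t)

  acyclic′ : ¬ Cycle edges
  acyclic′ cy@(m , c , inj , edge , closing) with any? (λ i → c i ≟ s)
  ... | yes (i , cᵢ≡s) with cycle-vertex-has-two-neighbours (λ {u} {v} → subst T (edges-sym u v)) cy i
  ...   | a , b , a≢b , ea , eb = a≢b (trans (only-neighbour-of-s (subst (λ w → T (edges w a)) cᵢ≡s ea))
                                         (sym (only-neighbour-of-s (subst (λ w → T (edges w b)) cᵢ≡s eb))))
  acyclic′ (m , c , inj , edge , closing) | no s∉c =
    acyclic t (m , c , inj , old-edge ∘ edge , old-edge closing)
    where
    old-edge : ∀ {i j} → T (edges (c i) (c j)) → T (inE t (c i) (c j))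
    old-edge {i} {j} e with edge-view e
    ... | old e′ = e′
    ... | s-p = ⊥-elim (s∉c (i , refl))
    ... | p-s = ⊥-elim (s∉c (j , refl))

  tree : Tree G
  tree = record { inV = vertices ; inE = edges ; inE-sym = edges-sym ; inE-adj = edges-adj
                ; inE-inV = edges-vertices ; connected = connected′ ; acyclic = acyclic′ }

  proper : (c : Colouring G k) → Proper c t →
    (∀ {w} (e : T (inE t p w)) → col c p w (inE-adj t p w e) ≢ col c s p sp) → Proper c tree
  proper c c-proper fresh u v w e₁ e₂ u≢w =
    go (edge-view e₁) (edge-view e₂) (edges-adj u v e₁) (edges-adj v w e₂)
    where
    inE-flip : ∀ {a b} → T (inE t a b) → T (inE t b a)
    inE-flip {a} {b} = subst T (inE-sym t a b)
    go : EdgeView u v → EdgeView v w → (a₁ : T (adj G u v)) (a₂ : T (adj G v w)) → col c u v a₁ ≢ col c v w a₂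
    go (old e) (old e′) a₁ a₂ eq = c-proper u v w e e′ u≢w (trans (col-irr c _ a₁) (trans eq (col-irr c a₂ _)))
    go (old e) s-p a₁ a₂ eq = s∉t (inE-inV t _ _ (inE-flip e))
    go (old e) p-s a₁ a₂ eq = fresh (inE-flip e) (trans (col-sym c p u _ a₁) (trans eq (col-sym c p s a₂ sp)))
    go s-p (old e) a₁ a₂ eq = fresh e (sym (trans (col-irr c sp a₁) (trans eq (col-irr c a₂ _))))
    go s-p s-p a₁ a₂ eq = s≢p refl
    go s-p p-s a₁ a₂ eq = u≢w refl
    go p-s (old e) a₁ a₂ eq = s∉t (inE-inV t _ _ e)
    go p-s s-p a₁ a₂ eq = u≢w refl
    go p-s p-s a₁ a₂ eq = s≢p refl

module Lift {G : Graph V} {D : V → Bool} (t : Tree (Induced G D)) where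

  vertices : V → Bool
  vertices u with T? (D u)
  ... | yes u∈D = inV t (u , u∈D)
  ... | no  _   = false

  edges : V → V → Bool
  edges u v with T? (D u) | T? (D v)
  ... | yes u∈D | yes v∈D = inE t (u , u∈D) (v , v∈D)
  ... | _       | _       = false

  vertices-≡ : ∀ {u} (u∈D : T (D u)) → vertices u ≡ inV t (u , u∈D)
  vertices-≡ {u} u∈D with T? (D u)
  ... | yes u∈D′ = cong (λ q → inV t (u , q)) (T-irrelevant u∈D′ u∈D)
  ... | no  u∉D  = ⊥-elim (u∉D u∈D)

  edges-≡ : ∀ {u v} (u∈D : T (D u)) (v∈D : T (D v)) → edges u v ≡ inE t (u , u∈D) (v , v∈D)
  edges-≡ {u} {v} u∈D v∈D with T? (D u) | T? (D v)
  ... | yes u∈D′ | yes v∈D′ =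
    cong₂ (λ q r → inE t (u , q) (v , r)) (T-irrelevant u∈D′ u∈D) (T-irrelevant v∈D′ v∈D)
  ... | no  u∉D  | _        = ⊥-elim (u∉D u∈D)
  ... | yes _    | no v∉D   = ⊥-elim (v∉D v∈D)

  vertices⊆D : ∀ {u} → T (vertices u) → T (D u)
  vertices⊆D {u} u∈ with T? (D u)
  ... | yes u∈D = u∈D

  edges⊆D : ∀ {u v} → T (edges u v) → T (D u) × T (D v)
  edges⊆D {u} {v} e with T? (D u) | T? (D v)
  ... | yes u∈D | yes v∈D = u∈D , v∈D

  lower-edge : ∀ {u v} (u∈D : T (D u)) (v∈D : T (D v)) → T (edges u v) → T (inE t (u , u∈D) (v , v∈D))
  lower-edge u∈D v∈D = subst T (edges-≡ u∈D v∈D)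

  lowered : ∀ {u v} (e : T (edges u v)) → T (inE t (u , proj₁ (edges⊆D e)) (v , proj₂ (edges⊆D e)))
  lowered e = lower-edge _ _ e

  raise-edge : ∀ {a b} → T (inE t a b) → T (edges (proj₁ a) (proj₁ b))
  raise-edge {a} {b} = subst T (sym (edges-≡ (proj₂ a) (proj₂ b)))

  raise-vertex : ∀ {a} → T (inV t a) → T (vertices (proj₁ a))
  raise-vertex {a} = subst T (sym (vertices-≡ (proj₂ a)))

  edges-sym : ∀ u v → edges u v ≡ edges v u
  edges-sym u v with T? (D u) | T? (D v)
  ... | yes u∈D | yes v∈D = inE-sym t (u , u∈D) (v , v∈D)
  ... | yes _   | no  _   = refl
  ... | no  _   | yes _   = refl
  ... | no  _   | no  _   = refl

  edges-adj : ∀ u v → T (edges u v) → T (adj G u v)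
  edges-adj u v e = inE-adj t _ _ (lowered e)

  edges-vertices : ∀ u v → T (edges u v) → T (vertices u)
  edges-vertices u v e = raise-vertex (inE-inV t _ _ (lowered e))

  connected′ : ∀ u v → T (vertices u) → T (vertices v) → Walk edges u v
  connected′ u v u∈ v∈ = mapWalk proj₁ raise-edge
    (connected t (u , vertices⊆D u∈) (v , vertices⊆D v∈) (subst T (vertices-≡ _) u∈) (subst T (vertices-≡ _) v∈))

  acyclic′ : ¬ Cycle edges
  acyclic′ cy@(m , c , inj , edge , closing) =
    acyclic t (m , c′ , inj ∘ cong proj₁ , lower-edge _ _ ∘ edge , lower-edge _ _ closing)
    where
    on-D : ∀ i → T (D (c i))
    on-D i with cycle-vertex-has-two-neighbours (λ {u} {v} → subst T (edges-sym u v)) cy i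
    ... | _ , _ , _ , e , _ = proj₁ (edges⊆D e)
    c′ : Fin (suc (suc (suc m))) → Σ V (T ∘ D)
    c′ i = c i , on-D i

  tree : Tree G
  tree = record { inV = vertices ; inE = edges ; inE-sym = edges-sym ; inE-adj = edges-adj
                ; inE-inV = edges-vertices ; connected = connected′ ; acyclic = acyclic′ }

singleton-tree : DecidableEquality V → {G : Graph V} → V → Tree G
singleton-tree _≟_ r = record
  { inV = λ u → ⌊ u ≟ r ⌋ ; inE = λ _ _ → false ; inE-sym = λ _ _ → refl ; inE-adj = λ _ _ ()
  ; inE-inV = λ _ _ ()
  ; connected = λ u v u≡r v≡r → subst (Walk _ u) (trans (toWitness u≡r) (sym (toWitness v≡r))) here
  ; acyclic = λ { (_ , _ , _ , _ , ()) } }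

-- Colourings

ThreeProperColourable : Graph V → ℕ → Set
ThreeProperColourable G k = Σ[ c ∈ Colouring G k ] ThreeProper c

recolour : {G : Graph V} {k k′ : ℕ} {f : Fin k → Fin k′} → Injective _≡_ _≡_ f →
  ThreeProperColourable G k → ThreeProperColourable G k′
recolour {G = G} {k′ = k′} {f = f} f-inj (c , c-3proper) = c′ , c′-3proper
  where
  c′ : Colouring G k′
  c′ = record { col = λ u v e → f (col c u v e) ; col-sym = λ u v e e′ → cong f (col-sym c u v e e′) }
  c′-3proper : ThreeProper c′
  c′-3proper x y z x≢y x≢z y≢z with c-3proper x y z x≢y x≢z y≢z
  ... | t , x∈ , y∈ , z∈ , t-proper = t , x∈ , y∈ , z∈ , λ u v w e₁ e₂ u≢w → t-proper u v w e₁ e₂ u≢w ∘ f-inj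

colourable-mono : {G : Graph V} {k k′ : ℕ} → k ≤ k′ → ThreeProperColourable G k → ThreeProperColourable G k′
colourable-mono k≤k′ = recolour {f = λ i → inject≤ i k≤k′} (λ {i} {j} → inject≤-injective k≤k′ k≤k′ i j)

px₃-≤ : {G : Graph V} {a k : ℕ} → IsPx3 G a → ThreeProperColourable G k → a ≤ k
px₃-≤ {a = a} {k} (_ , minimal) colourable with a ≤? k
... | yes a≤k = a≤k
... | no  a≰k = ⊥-elim (minimal k (≰⇒> a≰k) colourable)

px₃-exact : {G : Graph V} {k : ℕ} →
  ThreeProperColourable G (suc k) → ¬ ThreeProperColourable G k → IsPx3 G (suc k)
px₃-exact colourable ¬colourable = colourable , λ m m<1+k → ¬colourable ∘ colourable-mono (s≤s⁻¹ m<1+k)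

proper-star : DecidableEquality V → {G : Graph V} (c : Colouring G k) (t : Tree G) → Proper c t →
  ∀ {v a b} → T (inE t v a) → T (inE t v b) →
  (p : T (adj G v a)) (q : T (adj G v b)) → col c v a p ≡ col c v b q → a ≡ b
proper-star _≟_ c t t-proper {v} {a} {b} ea eb p q same with a ≟ b
... | yes a≡b = a≡b
... | no  a≢b = ⊥-elim (t-proper a v b (subst T (inE-sym t v a) ea) eb a≢b
      (trans (col-sym c a v _ p) (trans same (col-irr c q _))))

Leaf : (V → V → Bool) → V → Set
Leaf {V} E v = ∀ {a b : V} → T (E v a) → T (E v b) → a ≡ b

walk-when-all-leaves : {E : V → V → Bool} → SymmetricEdges E → (∀ v → Leaf E v) →
  ∀ {x y} → Walk E x y → x ≡ y ⊎ T (E x y)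
walk-when-all-leaves E-sym leaf here = inj₁ refl
walk-when-all-leaves E-sym leaf (step e w) with walk-when-all-leaves E-sym leaf w
... | inj₁ refl = inj₂ e
... | inj₂ e′   = inj₁ (leaf _ (E-sym e) e′)

one-colour-insufficient : DecidableEquality V → {G : Graph V} {x y z : V} → x ≢ y → x ≢ z → y ≢ z →
  ¬ ThreeProperColourable G 1
one-colour-insufficient _≟_ {x = x} {y} {z} x≢y x≢z y≢z (c , c-3proper) with c-3proper x y z x≢y x≢z y≢z
... | t , x∈ , y∈ , z∈ , t-proper = conclude (joined y∈) (joined z∈)
  where
  single : (i j : Fin 1) → i ≡ j
  single zero zero = refl
  tree-sym : SymmetricEdges (inE t)
  tree-sym {u} {v} = subst T (inE-sym t u v)
  leaf : ∀ v → Leaf (inE t) v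
  leaf v ea eb = proper-star _≟_ c t t-proper ea eb (inE-adj t v _ ea) (inE-adj t v _ eb) (single _ _)
  joined : ∀ {w} → T (inV t w) → x ≡ w ⊎ T (inE t x w)
  joined w∈ = walk-when-all-leaves tree-sym leaf (connected t _ _ x∈ w∈)
  conclude : x ≡ y ⊎ T (inE t x y) → x ≡ z ⊎ T (inE t x z) → ⊥
  conclude (inj₁ x≡y) _          = x≢y x≡y
  conclude (inj₂ _)   (inj₁ x≡z) = x≢z x≡z
  conclude (inj₂ exy) (inj₂ exz) = y≢z (leaf x exy exz)

MaxDegree≤2 : (V → V → Bool) → Set
MaxDegree≤2 {V} E = ∀ {v a b d : V} → T (E v a) → T (E v b) → T (E v d) → a ≡ b ⊎ a ≡ d ⊎ b ≡ d

module MaxDegreeTwo (_≟_ : DecidableEquality V) {E : V → V → Bool} (E-sym : SymmetricEdges E) where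

  Fresh : Maybe V → V → Set
  Fresh nothing  _ = ⊤
  Fresh (just u) w = u ≢ w

  -- Non-backtracking walks; the index records the vertex the walk has just come from.
  data NBWalk : Maybe V → V → V → Set where
    stop : ∀ {from v} → NBWalk from v v
    go   : ∀ {from v w y} → T (E v w) → Fresh from w → NBWalk (just v) w y → NBWalk from v y

  forget : ∀ {u v y} → NBWalk (just u) v y → NBWalk nothing v y
  forget stop          = stop
  forget (go e _ rest) = go e tt rest

  reduce : ∀ {u v} → Walk E u v → NBWalk nothing u v
  reduce here = stop
  reduce (step {u} e p) with reduce p
  ... | stop = go e tt stop
  ... | go {w = a} e′ _ rest with a ≟ u
  ...   | yes refl = forget rest
  ...   | no  a≢u  = go e tt (go e′ (a≢u ∘ sym) rest)

  Entry : Maybe V → V → Set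
  Entry nothing  v = Leaf E v
  Entry (just u) v = T (E v u)

  Departs : Maybe V → V → V → Set
  Departs nothing  v y = v ≢ y
  Departs (just _) _ _ = ⊤

  -- With maximum degree 2 a non-backtracking walk has at most one way to continue.
  no-fork : MaxDegree≤2 E → ∀ {from v y z} → Entry from v → Leaf E y → Leaf E z → y ≢ z →
    Departs from v y → Departs from v z → NBWalk from v y → NBWalk from v z → ⊥
  no-fork deg entry leaf-y leaf-z y≢z dy dz stop stop = y≢z refl
  no-fork deg {nothing} entry leaf-y leaf-z y≢z dy dz stop (go _ _ _) = dy refl
  no-fork deg {just u}  entry leaf-y leaf-z y≢z dy dz stop (go e u≢w _) = u≢w (leaf-y entry e)
  no-fork deg {nothing} entry leaf-y leaf-z y≢z dy dz (go _ _ _) stop = dz refl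
  no-fork deg {just u}  entry leaf-y leaf-z y≢z dy dz (go e u≢w _) stop = u≢w (leaf-z entry e)
  no-fork deg {from} {v} entry leaf-y leaf-z y≢z dy dz
          (go {w = w₁} e₁ fresh₁ rest₁) (go {w = w₂} e₂ fresh₂ rest₂) =
    continue (same-step from entry fresh₁ fresh₂) rest₂
    where
    same-step : ∀ from → Entry from v → Fresh from w₁ → Fresh from w₂ → w₁ ≡ w₂
    same-step nothing  leaf-v _ _ = leaf-v e₁ e₂
    same-step (just u) back u≢w₁ u≢w₂ with deg back e₁ e₂
    ... | inj₁ u≡w₁         = ⊥-elim (u≢w₁ u≡w₁)
    ... | inj₂ (inj₁ u≡w₂)  = ⊥-elim (u≢w₂ u≡w₂)
    ... | inj₂ (inj₂ w₁≡w₂) = w₁≡w₂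
    continue : w₁ ≡ w₂ → NBWalk (just v) w₂ _ → ⊥
    continue refl rest₂′ = no-fork deg (E-sym e₁) leaf-y leaf-z y≢z tt tt rest₁ rest₂′

  three-leaves : MaxDegree≤2 E → ∀ {x y z} → Leaf E x → Leaf E y → Leaf E z → x ≢ y → x ≢ z → y ≢ z →
    Walk E x y → Walk E x z → ⊥
  three-leaves deg leaf-x leaf-y leaf-z x≢y x≢z y≢z p q =
    no-fork deg (λ {a} {b} → leaf-x {a} {b}) leaf-y leaf-z y≢z x≢y x≢z (reduce p) (reduce q)

two-valued-triple : (p q r : Fin 2) → p ≡ q ⊎ p ≡ r ⊎ q ≡ r
two-valued-triple zero       zero       _          = inj₁ refl
two-valued-triple (suc zero) (suc zero) _          = inj₁ refl
two-valued-triple zero       (suc zero) zero       = inj₂ (inj₁ refl)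
two-valued-triple (suc zero) zero       (suc zero) = inj₂ (inj₁ refl)
two-valued-triple zero       (suc zero) (suc zero) = inj₂ (inj₂ refl)
two-valued-triple (suc zero) zero       zero       = inj₂ (inj₂ refl)

two-colour-max-degree : DecidableEquality V → {G : Graph V} (c : Colouring G 2) (t : Tree G) → Proper c t →
  MaxDegree≤2 (inE t)
two-colour-max-degree _≟_ c t t-proper {v} {a} {b} {d} ea eb ed
  with two-valued-triple (col c v a (inE-adj t v a ea)) (col c v b (inE-adj t v b eb))
                         (col c v d (inE-adj t v d ed))
... | inj₁ same        = inj₁ (proper-star _≟_ c t t-proper ea eb _ _ same)
... | inj₂ (inj₁ same) = inj₂ (inj₁ (proper-star _≟_ c t t-proper ea ed _ _ same))
... | inj₂ (inj₂ same) = inj₂ (inj₂ (proper-star _≟_ c t t-proper eb ed _ _ same))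

first-edge : {E : V → V → Bool} {u v : V} → u ≢ v → Walk E u v → Σ[ w ∈ V ] T (E u w)
first-edge u≢u here       = ⊥-elim (u≢u refl)
first-edge _   (step e _) = _ , e

-- The upper bound

avoid-one : DecidableEquality V → {P : V → Set} {d₁ d₂ : V} → d₁ ≢ d₂ → P d₁ → P d₂ →
  (a : V) → Σ[ d ∈ V ] (P d × d ≢ a)
avoid-one _≟_ {d₁ = d₁} d₁≢d₂ P₁ P₂ a with d₁ ≟ a
... | no  d₁≢a = d₁ , P₁ , d₁≢a
... | yes refl = _ , P₂ , d₁≢d₂ ∘ sym

avoid-two : DecidableEquality V → {P : V → Set} {d₁ d₂ d₃ : V} → d₁ ≢ d₂ → d₁ ≢ d₃ → d₂ ≢ d₃ →
  P d₁ → P d₂ → P d₃ → (a b : V) → Σ[ d ∈ V ] (P d × d ≢ a × d ≢ b)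
avoid-two _≟_ {d₁ = d₁} d₁≢d₂ d₁≢d₃ d₂≢d₃ P₁ P₂ P₃ a b with d₁ ≟ a | d₁ ≟ b
... | no d₁≢a | no d₁≢b = d₁ , P₁ , d₁≢a , d₁≢b
... | yes refl | _ with avoid-one _≟_ d₂≢d₃ (P₂ , d₁≢d₂ ∘ sym) (P₃ , d₁≢d₃ ∘ sym) b
...   | d , (Pd , d≢a) , d≢b = d , Pd , d≢a , d≢b
avoid-two _≟_ d₁≢d₂ d₁≢d₃ d₂≢d₃ P₁ P₂ P₃ a b | no _ | yes refl
      with avoid-one _≟_ d₂≢d₃ (P₂ , d₁≢d₂ ∘ sym) (P₃ , d₁≢d₃ ∘ sym) a
...   | d , (Pd , d≢b) , d≢a = d , Pd , d≢a , d≢b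

ThreeDominating : Graph V → (V → Bool) → Set
ThreeDominating {V} G D = ∀ (v : V) → D v ≡ false → Σ[ a ∈ V ] Σ[ b ∈ V ] Σ[ c ∈ V ]
  (a ≢ b × a ≢ c × b ≢ c × T (D a) × T (D b) × T (D c)
   × T (adj G v a) × T (adj G v b) × T (adj G v c))

module Extension (_≟_ : DecidableEquality V) {G : Graph V} {D : V → Bool} (dominating : ThreeDominating G D)
  (c₀ : Colouring (Induced G D) k) (c₀-3proper : ThreeProper c₀) where

  colour : (u v : V) → T (adj G u v) → Fin (suc k)
  colour u v e with T? (D u) | T? (D v)
  ... | yes u∈D | yes v∈D = inject₁ (col c₀ (u , u∈D) (v , v∈D) e)
  ... | _       | _       = fromℕ k

  colour-inner : ∀ {u v} (u∈D : T (D u)) (v∈D : T (D v)) {e e′ : T (adj G u v)} →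
    colour u v e ≡ inject₁ (col c₀ (u , u∈D) (v , v∈D) e′)
  colour-inner {u} {v} u∈D v∈D {e} {e′} with T? (D u) | T? (D v)
  ... | yes u∈D′ | yes v∈D′ rewrite T-irrelevant u∈D′ u∈D | T-irrelevant v∈D′ v∈D =
    cong inject₁ (col-irr c₀ e e′)
  ... | no  u∉D  | _        = ⊥-elim (u∉D u∈D)
  ... | yes _    | no v∉D   = ⊥-elim (v∉D v∈D)

  colour-outer : ∀ {u v} → ¬ T (D u) → (e : T (adj G u v)) → colour u v e ≡ fromℕ k
  colour-outer {u} {v} u∉D e with T? (D u) | T? (D v)
  ... | yes u∈D | _     = ⊥-elim (u∉D u∈D)
  ... | no  _   | yes _ = refl
  ... | no  _   | no  _ = refl

  colour-sym : ∀ u v (e : T (adj G u v)) (e′ : T (adj G v u)) → colour u v e ≡ colour v u e′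
  colour-sym u v e e′ with T? (D u) | T? (D v)
  ... | yes u∈D | yes v∈D = cong inject₁ (col-sym c₀ (u , u∈D) (v , v∈D) e e′)
  ... | yes _   | no  _   = refl
  ... | no  _   | yes _   = refl
  ... | no  _   | no  _   = refl

  extended : Colouring G (suc k)
  extended = record { col = colour ; col-sym = colour-sym }

  lift-proper : ∀ {t} → Proper c₀ t → Proper extended (Lift.tree t)
  lift-proper {t} t-proper u v w e₁ e₂ u≢w same =
    t-proper (u , u∈D) (v , v∈D) (w , w∈D) (lower-edge u∈D v∈D e₁) (lower-edge v∈D w∈D e₂) (u≢w ∘ cong proj₁)
      (inject₁-injective (trans (sym (colour-inner u∈D v∈D)) (trans same (colour-inner v∈D w∈D))))
    where
    open Lift t using (lower-edge; edges⊆D)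
    u∈D : T (D u)
    u∈D = proj₁ (edges⊆D e₁)
    v∈D : T (D v)
    v∈D = proj₂ (edges⊆D e₁)
    w∈D : T (D w)
    w∈D = proj₂ (edges⊆D e₂)

  data EdgeKind (P : Pred V 0ℓ) (u v : V) : Set where
    inner   : T (D u) → T (D v) → EdgeKind P u v
    inward  : ¬ T (D u) → v ∈ P → EdgeKind P u v
    outward : u ∈ P → ¬ T (D v) → EdgeKind P u v

  EdgeKind-mono : ∀ {P Q u v} → P ⊆ Q → EdgeKind P u v → EdgeKind Q u v
  EdgeKind-mono P⊆Q (inner u∈D v∈D)   = inner u∈D v∈D
  EdgeKind-mono P⊆Q (inward u∉D v∈P)  = inward u∉D (P⊆Q v∈P)
  EdgeKind-mono P⊆Q (outward u∈P v∉D) = outward (P⊆Q u∈P) v∉D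

  -- P collects the anchors in D of the pendant edges attached so far, S their outer ends.
  record PendantTree (P S : Pred V 0ℓ) : Set where
    field
      tree      : Tree G
      proper    : Proper extended tree
      edge-kind : ∀ {u v} → T (inE tree u v) → EdgeKind P u v
      outside-D : ∀ {u} → T (inV tree u) → ¬ T (D u) → u ∈ S

  open PendantTree

  lifted : (t : Tree (Induced G D)) → Proper c₀ t → PendantTree ∅ ∅
  lifted t t-proper = record
    { tree = Lift.tree t
    ; proper = lift-proper t-proper
    ; edge-kind = λ e → let (u∈D , v∈D) = Lift.edges⊆D t e in inner u∈D v∈D
    ; outside-D = λ u∈ u∉D → u∉D (Lift.vertices⊆D t u∈) }

  record Representative (s a b : V) : Set where
    field
      rep   : V
      rep∈D : T (D rep)
      rep≢a : rep ≢ a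
      rep≢b : rep ≢ b
      link  : rep ≡ s ⊎ (¬ T (D s) × T (adj G s rep))

  open Representative

  representative : ∀ s {a b} → s ≢ a → s ≢ b → Representative s a b
  representative s {a} {b} s≢a s≢b with D s in D-s
  ... | true  = record { rep = s ; rep∈D = subst T (sym D-s) _ ; rep≢a = s≢a ; rep≢b = s≢b ; link = inj₁ refl }
  ... | false with dominating s D-s
  ...   | d₁ , d₂ , d₃ , d₁≢d₂ , d₁≢d₃ , d₂≢d₃ , d₁∈D , d₂∈D , d₃∈D , sd₁ , sd₂ , sd₃
        with avoid-two _≟_ {P = λ d → T (D d) × T (adj G s d)} d₁≢d₂ d₁≢d₃ d₂≢d₃
               (d₁∈D , sd₁) (d₂∈D , sd₂) (d₃∈D , sd₃) a b
  ...     | p , (p∈D , sp) , p≢a , p≢b =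
            record { rep = p ; rep∈D = p∈D ; rep≢a = p≢a ; rep≢b = p≢b ; link = inj₂ (subst T D-s , sp) }

  Grows : ∀ {P S P′ S′} → PendantTree P S → PendantTree P′ S′ → Set
  Grows st st′ = ∀ {u} → T (inV (tree st) u) → T (inV (tree st′) u)

  attach-pendant : ∀ {P S s p} (st : PendantTree P S) → ¬ T (D s) → T (adj G s p) → T (D p) →
    T (inV (tree st) p) → s ∉ S → p ∉ P →
    Σ[ st′ ∈ PendantTree (P ∪ ｛ p ｝) (S ∪ ｛ s ｝) ] (Grows st st′ × T (inV (tree st′) s))
  attach-pendant {P} {S} {s} {p} st s∉D sp p∈D p∈t s∉S p∉P =
    record { tree = A.tree ; proper = A.proper extended (proper st) fresh
           ; edge-kind = edge-kind′ ; outside-D = outside-D′ } , A.old∈ , A.s∈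
    where
    module A = Pendant _≟_ (tree st) sp p∈t (λ s∈t → s∉S (outside-D st s∈t s∉D))
    fresh : ∀ {w} (e : T (inE (tree st) p w)) → colour p w (inE-adj (tree st) p w e) ≢ colour s p sp
    fresh e same with edge-kind st e
    ... | inner _ w∈D   = fromℕ≢inject₁ (trans (sym (colour-outer s∉D sp))
                            (trans (sym same) (colour-inner p∈D w∈D {e′ = inE-adj (tree st) p _ e})))
    ... | inward p∉D _  = p∉D p∈D
    ... | outward p∈P _ = p∉P p∈P
    edge-kind′ : ∀ {u v} → T (A.edges u v) → EdgeKind (P ∪ ｛ p ｝) u v
    edge-kind′ e with A.edge-view e
    ... | A.old e′ = EdgeKind-mono inj₁ (edge-kind st e′)
    ... | A.s-p    = inward s∉D (inj₂ refl)
    ... | A.p-s    = outward (inj₂ refl) s∉D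
    outside-D′ : ∀ {u} → T (A.vertices u) → ¬ T (D u) → u ∈ (S ∪ ｛ s ｝)
    outside-D′ u∈ u∉D with A.vertex-view u∈
    ... | A.old u∈t = inj₁ (outside-D st u∈t u∉D)
    ... | A.new     = inj₂ refl

  attach : ∀ {P S s a b} (st : PendantTree P S) (r : Representative s a b) →
    T (inV (tree st) (rep r)) → s ∉ S → rep r ∉ P →
    Σ[ st′ ∈ PendantTree (P ∪ ｛ rep r ｝) (S ∪ ｛ s ｝) ] (Grows st st′ × T (inV (tree st′) s))
  attach st r p∈t s∉S p∉P with link r
  ... | inj₁ refl = record { tree = tree st ; proper = proper st ; edge-kind = EdgeKind-mono inj₁ ∘ edge-kind st
                           ; outside-D = λ u∈ u∉D → inj₁ (outside-D st u∈ u∉D) } , id , p∈t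
  ... | inj₂ (s∉D , sp) = attach-pendant st s∉D sp (rep∈D r) p∈t s∉S p∉P

  -- The representatives are chosen one after another, each avoiding the earlier representatives
  -- and the later vertices; this keeps the three pendant edges pairwise disjoint.
  module _ {x y z : V} (x≢y : x ≢ y) (x≢z : x ≢ z) (y≢z : y ≢ z) where
    private
      rx : Representative x y z
      rx = representative x x≢y x≢z
      ry : Representative y (rep rx) z
      ry = representative y (rep≢a rx ∘ sym) y≢z
      rz : Representative z (rep rx) (rep ry)
      rz = representative z (rep≢b rx ∘ sym) (rep≢b ry ∘ sym)
      x′ y′ z′ : Σ V (T ∘ D)
      x′ = rep rx , rep∈D rx
      y′ = rep ry , rep∈D ry
      z′ = rep rz , rep∈D rz

    proper-tree-through : Σ[ t ∈ Tree G ] (T (inV t x) × T (inV t y) × T (inV t z) × Proper extended t)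
    proper-tree-through
      with c₀-3proper x′ y′ z′
             (rep≢a ry ∘ sym ∘ cong proj₁) (rep≢a rz ∘ sym ∘ cong proj₁) (rep≢b rz ∘ sym ∘ cong proj₁)
    ... | t₀ , x′∈ , y′∈ , z′∈ , t₀-proper
      with attach (lifted t₀ t₀-proper) rx (Lift.raise-vertex t₀ x′∈) (λ ()) (λ ())
    ... | st₁ , grow₁ , x∈₁
      with attach st₁ ry (grow₁ (Lift.raise-vertex t₀ y′∈)) [ (λ ()) , x≢y ] [ (λ ()) , rep≢a ry ∘ sym ]
    ... | st₂ , grow₂ , y∈₂
      with attach st₂ rz (grow₂ (grow₁ (Lift.raise-vertex t₀ z′∈)))
                  [ [ (λ ()) , x≢z ] , y≢z ] [ [ (λ ()) , rep≢a rz ∘ sym ] , rep≢b rz ∘ sym ]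
    ... | st₃ , grow₃ , z∈₃ = tree st₃ , grow₃ (grow₂ x∈₁) , grow₃ y∈₂ , z∈₃ , proper st₃

  extended-3proper : ThreeProper extended
  extended-3proper x y z = proper-tree-through


dominating-set-colourable : DecidableEquality V → {G : Graph V} {D : V → Bool} → ThreeDominating G D →
  ThreeProperColourable (Induced G D) k → ThreeProperColourable G (suc k)
dominating-set-colourable _≟_ dominating (c , c-3proper) =
  Extension.extended _≟_ dominating c c-3proper , Extension.extended-3proper _≟_ dominating c c-3proper

px₃-dominating-set-bound : DecidableEquality V → {G : Graph V} {D : V → Bool} → ThreeDominating G D →
  ∀ {a b} → IsPx3 G a → IsPx3 (Induced G D) b → a ≤ suc b
px₃-dominating-set-bound _≟_ dominating G-px₃ G[D]-px₃ =
  px₃-≤ G-px₃ (dominating-set-colourable _≟_ dominating (proj₁ G[D]-px₃))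

-- Pigeonhole arguments

half-of-odd : ∀ k m n → suc (k + k) ≤ m + n → suc k ≤ m ⊎ suc k ≤ n
half-of-odd k m n h with suc k ≤? m
... | yes k<m = inj₁ k<m
... | no  k≮m = inj₂ (+-cancelˡ-≤ k (suc k) n (begin
  k + suc k    ≡⟨ +-suc k k ⟩
  suc (k + k)  ≤⟨ h ⟩
  m + n        ≤⟨ +-monoˡ-≤ n (s≤s⁻¹ (≰⇒> k≮m)) ⟩
  k + n        ∎))
  where open ≤-Reasoning

module _ {A : Set} (f : A → Fin 2) where

  class : Fin 2 → List A → List A
  class b = filter (λ x → f x ≟ b)

  classes-partition : ∀ xs → length (class zero xs) + length (class (suc zero) xs) ≡ length xs
  classes-partition [] = refl
  classes-partition (x ∷ xs) with f x
  ... | zero     = cong suc (classes-partition xs)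
  ... | suc zero = trans (+-suc _ _) (cong suc (classes-partition xs))

  majority : ∀ k {xs} → Unique xs → suc (k + k) ≤ length xs →
    Σ[ ys ∈ List A ] (Unique ys × (∀ {P : A → Set} → All P xs → All P ys)
      × Σ[ b ∈ Fin 2 ] (All (λ x → f x ≡ b) ys × suc k ≤ length ys))
  majority k {xs} xs-unique big
    with half-of-odd k _ _ (subst (suc (k + k) ≤_) (sym (classes-partition xs)) big)
  ... | inj₁ big₀ = class zero xs , filter⁺ᵁ _ xs-unique , filter⁺ _ , zero , all-filter _ xs , big₀
  ... | inj₂ big₁ = class (suc zero) xs , filter⁺ᵁ _ xs-unique , filter⁺ _ , suc zero , all-filter _ xs , big₁

three-members : {A : Set} {xs : List A} → Unique xs → 3 ≤ length xs →
  Σ[ x ∈ A ] Σ[ y ∈ A ] Σ[ z ∈ A ] (x ≢ y × x ≢ z × y ≢ z × (∀ {P : A → Set} → All P xs → P x × P y × P z))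
three-members {xs = _ ∷ []} _ (s≤s ())
three-members {xs = _ ∷ _ ∷ []} _ (s≤s (s≤s ()))
three-members {xs = x ∷ y ∷ z ∷ _} ((x≢y ∷ x≢z ∷ _) ∷ (y≢z ∷ _) ∷ _) _ =
  x , y , z , x≢y , x≢z , y≢z , λ { (px ∷ py ∷ pz ∷ _) → px , py , pz }

-- 17 = 2 · 8 + 1: fixing one coordinate at a time by majority leaves 9, then 5, then 3 elements.
same-pattern-triple : {A : Set} (f : Fin 3 → A → Fin 2) {xs : List A} → Unique xs → 17 ≤ length xs →
  Σ[ x ∈ A ] Σ[ y ∈ A ] Σ[ z ∈ A ] (x ≢ y × x ≢ z × y ≢ z × (∀ i → f i x ≡ f i y) × (∀ i → f i x ≡ f i z))
same-pattern-triple f unique big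
  with majority (f zero) 8 unique big
... | _ , unique₀ , _ , _ , all₀ , big₀ with majority (f (suc zero)) 4 unique₀ big₀
... | _ , unique₁ , keep₁ , _ , all₁ , big₁ with majority (f (suc (suc zero))) 2 unique₁ big₁
... | _ , unique₂ , keep₂ , _ , all₂ , big₂ with three-members unique₂ big₂
... | x , y , z , x≢y , x≢z , y≢z , members = x , y , z , x≢y , x≢z , y≢z , proj₁ ∘ agree , proj₂ ∘ agree
  where
  shared : ∀ {a b c d : Fin 2} → a ≡ d × b ≡ d × c ≡ d → a ≡ b × a ≡ c
  shared (refl , refl , refl) = refl , refl
  agree : ∀ i → f i x ≡ f i y × f i x ≡ f i z
  agree zero             = shared (members (keep₂ (keep₁ all₀)))
  agree (suc zero)       = shared (members (keep₂ all₁))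
  agree (suc (suc zero)) = shared (members all₂)

no-four-in-Fin3 : {a b c d : Fin 3} → a ≢ b → a ≢ c → a ≢ d → b ≢ c → b ≢ d → c ≢ d → ⊥
no-four-in-Fin3 {a} {b} {c} {d} a≢b a≢c a≢d b≢c b≢d c≢d
  with pigeonhole (s≤s (s≤s (s≤s (s≤s z≤n)))) (lookup (a ∷ b ∷ c ∷ d ∷ []))
... | zero              , suc zero             , _ , eq = a≢b eq
... | zero              , suc (suc zero)       , _ , eq = a≢c eq
... | zero              , suc (suc (suc zero)) , _ , eq = a≢d eq
... | suc zero          , suc (suc zero)       , _ , eq = b≢c eq
... | suc zero          , suc (suc (suc zero)) , _ , eq = b≢d eq
... | suc (suc zero)    , suc (suc (suc zero)) , _ , eq = c≢d eq
... | suc zero          , suc zero             , s≤s () , _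
... | suc (suc _)       , suc zero             , s≤s () , _
... | suc (suc _)       , suc (suc zero)       , s≤s (s≤s ()) , _
... | suc (suc (suc _)) , suc (suc (suc zero)) , s≤s (s≤s (s≤s ())) , _

-- The extremal example

-- K is the triangle on 0, 1, 2 (the core) joined to the 17 independent outer vertices 3, …, 19.
inCore : Fin 20 → Bool
inCore zero             = true
inCore (suc zero)       = true
inCore (suc (suc zero)) = true
inCore (suc (suc (suc _))) = false

K : Graph (Fin 20)
K = record
  { adj      = λ u v → (inCore u ∨ inCore v) ∧ not ⌊ u ≟ v ⌋
  ; adj-sym  = λ u v → cong₂ (λ a b → a ∧ not b) (∨-comm (inCore u) (inCore v)) (≟-sym _≟_ u v)
  ; loopless = λ v → trans (cong (λ d → (inCore v ∨ inCore v) ∧ not ⌊ d ⌋) (≡-≟-identity _≟_ refl)) (∧-zeroʳ _) }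

core : Fin 3 → Fin 20
core i = i ↑ˡ 17

outer : Fin 17 → Fin 20
outer j = 3 ↑ʳ j

Core : Set
Core = Σ (Fin 20) (T ∘ inCore)

_≟ᶜ_ : DecidableEquality Core
_≟ᶜ_ = ≡-dec _≟_ (λ p q → yes (T-irrelevant p q))

K[Core] : Graph Core
K[Core] = Induced K inCore

v₀ v₁ v₂ : Core
v₀ = zero , _
v₁ = suc zero , _
v₂ = suc (suc zero) , _

-- The path v₀ – v₁ – v₂, grown from v₁ by two pendant edges; its edge v₁v₂ gets colour 1.
path-colouring : Colouring K[Core] 2
path-colouring = record
  { col = λ u v _ → if touches-v₂ u ∨ touches-v₂ v then suc zero else zero
  ; col-sym = λ u v _ _ → cong (λ b → if b then suc zero else zero) (∨-comm (touches-v₂ u) (touches-v₂ v)) }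
  where
  touches-v₂ : Core → Bool
  touches-v₂ u = ⌊ proj₁ u ≟ suc (suc zero) ⌋

module Path₁ = Pendant _≟ᶜ_ (singleton-tree _≟ᶜ_ {K[Core]} v₁) {s = v₀} {p = v₁} tt tt (λ ())

v₂∉Path₁ : ¬ T (Path₁.vertices v₂)
v₂∉Path₁ v₂∈ with Path₁.vertex-view {v₂} v₂∈
... | Path₁.old ()

module Path₂ = Pendant _≟ᶜ_ Path₁.tree {s = v₂} {p = v₁} tt (Path₁.old∈ {v₁} tt) v₂∉Path₁

path : Tree K[Core]
path = Path₂.tree

path-spans : ∀ u → T (inV path u)
path-spans (zero , _)             = Path₂.old∈ {v₀} Path₁.s∈
path-spans (suc zero , _)         = Path₂.old∈ {v₁} (Path₁.old∈ {v₁} tt)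
path-spans (suc (suc zero) , _)   = Path₂.s∈
path-spans (suc (suc (suc _)) , ())

path-proper : Proper path-colouring path
path-proper = Path₂.proper path-colouring (Path₁.proper path-colouring (λ _ _ _ ()) (λ ())) fresh
  where
  fresh : ∀ {w} (e : T (Path₁.edges v₁ w)) →
    col path-colouring v₁ w (inE-adj Path₁.tree v₁ w e) ≢ col path-colouring v₂ v₁ tt
  fresh {w} e with Path₁.edge-view {v₁} {w} e
  ... | Path₁.old ()
  ... | Path₁.p-s = λ ()

path-colouring-3proper : ThreeProper path-colouring
path-colouring-3proper x y z _ _ _ = path , path-spans x , path-spans y , path-spans z , path-proper

core-≡ : {u v : Core} → proj₁ u ≡ proj₁ v → u ≡ v
core-≡ {u , p} {.u , q} refl = cong (u ,_) (T-irrelevant p q)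

K-connected : Connected K
K-connected = connected-via-hub _≟_ {K} zero (≢⇒T-not _≟_)

K-min-degree : MinDeg≥3 K
K-min-degree zero                = suc zero , suc (suc zero) , outer zero , (λ ()) , (λ ()) , (λ ()) , tt , tt , tt
K-min-degree (suc zero)          = zero , suc (suc zero) , outer zero , (λ ()) , (λ ()) , (λ ()) , tt , tt , tt
K-min-degree (suc (suc zero))    = zero , suc zero , outer zero , (λ ()) , (λ ()) , (λ ()) , tt , tt , tt
K-min-degree (suc (suc (suc _))) = zero , suc zero , suc (suc zero) , (λ ()) , (λ ()) , (λ ()) , tt , tt , tt

core-dominates : ThreeDominating K inCore
core-dominates (suc (suc (suc _))) _ =
  zero , suc zero , suc (suc zero) , (λ ()) , (λ ()) , (λ ()) , tt , tt , tt , tt , tt , tt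

core-connected-dominating : Connected3Dominating K inCore
core-connected-dominating =
  core-dominates , connected-via-hub _≟ᶜ_ {K[Core]} v₀ (λ v₀≢v → ≢⇒T-not _≟_ (v₀≢v ∘ core-≡))

core-outer : ∀ i j → T (adj K (core i) (outer j))
core-outer zero             j = tt
core-outer (suc zero)       j = tt
core-outer (suc (suc zero)) j = tt

outer-neighbour : ∀ j {w} → T (adj K (outer j) w) → Σ[ i ∈ Fin 3 ] w ≡ core i
outer-neighbour j {zero}             _ = zero , refl
outer-neighbour j {suc zero}         _ = suc zero , refl
outer-neighbour j {suc (suc zero)}   _ = suc (suc zero) , refl

outer-injective : ∀ {j j′} → outer j ≡ outer j′ → j ≡ j′
outer-injective = suc-injective ∘ suc-injective ∘ suc-injective

module TwoColouredK (c : Colouring K 2) (c-3proper : ThreeProper c) where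

  spoke-colour : Fin 3 → Fin 17 → Fin 2
  spoke-colour i j = col c (core i) (outer j) (core-outer i j)

  SamePattern : Fin 17 → Fin 17 → Set
  SamePattern j j′ = ∀ i → spoke-colour i j ≡ spoke-colour i j′

  module InTree (t : Tree K) (t-proper : Proper c t) where

    tree-sym : SymmetricEdges (inE t)
    tree-sym {u} {v} = subst T (inE-sym t u v)

    one-spoke-per-pattern : ∀ {i j j′} → SamePattern j j′ →
      T (inE t (outer j) (core i)) → T (inE t (outer j′) (core i)) → j ≡ j′
    one-spoke-per-pattern {i} {j} {j′} same e e′ = outer-injective
      (proper-star _≟_ c t t-proper (tree-sym e) (tree-sym e′) (core-outer i j) (core-outer i j′) (same i))

    spoke : ∀ j {w} → T (inE t (outer j) w) → Σ[ i ∈ Fin 3 ] w ≡ core i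
    spoke j {w} e = outer-neighbour j (inE-adj t (outer j) w e)

    -- Two spokes at outer j and one each at outer j′, outer j″ would need four distinct core vertices.
    outer-leaf : ∀ {j j′ j″} → j ≢ j′ → j ≢ j″ → j′ ≢ j″ → SamePattern j j′ → SamePattern j j″ →
      T (inV t (outer j)) → T (inV t (outer j′)) → T (inV t (outer j″)) → Leaf (inE t) (outer j)
    outer-leaf {j} {j′} {j″} j≢j′ j≢j″ j′≢j″ same′ same″ j∈ j′∈ j″∈ {a} {b} ea eb with a ≟ b
    ... | yes a≡b = a≡b
    ... | no  a≢b with spoke j ea | spoke j eb
                     | first-edge (j≢j′ ∘ sym ∘ outer-injective) (connected t _ _ j′∈ j∈)
                     | first-edge (j≢j″ ∘ sym ∘ outer-injective) (connected t _ _ j″∈ j∈)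
    ...   | i₁ , refl | i₂ , refl | _ , e′ | _ , e″ with spoke j′ e′ | spoke j″ e″
    ...     | i′ , refl | i″ , refl = ⊥-elim (no-four-in-Fin3 {i₁} {i₂} {i′} {i″}
              (a≢b ∘ cong core)
              (λ { refl → j≢j′ (one-spoke-per-pattern same′ ea e′) })
              (λ { refl → j≢j″ (one-spoke-per-pattern same″ ea e″) })
              (λ { refl → j≢j′ (one-spoke-per-pattern same′ eb e′) })
              (λ { refl → j≢j″ (one-spoke-per-pattern same″ eb e″) })
              (λ { refl → j′≢j″ (one-spoke-per-pattern (λ i → trans (sym (same′ i)) (same″ i)) e′ e″) }))

  no-proper-tree : (Σ[ j₁ ∈ Fin 17 ] Σ[ j₂ ∈ Fin 17 ] Σ[ j₃ ∈ Fin 17 ]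
    (j₁ ≢ j₂ × j₁ ≢ j₃ × j₂ ≢ j₃ × SamePattern j₁ j₂ × SamePattern j₁ j₃)) → ⊥
  no-proper-tree (j₁ , j₂ , j₃ , j₁≢j₂ , j₁≢j₃ , j₂≢j₃ , same₁₂ , same₁₃)
    with c-3proper (outer j₁) (outer j₂) (outer j₃)
           (j₁≢j₂ ∘ outer-injective) (j₁≢j₃ ∘ outer-injective) (j₂≢j₃ ∘ outer-injective)
  ... | t , j₁∈ , j₂∈ , j₃∈ , t-proper =
    MaxDegreeTwo.three-leaves _≟_ tree-sym (two-colour-max-degree _≟_ c t t-proper)
      leaf₁ leaf₂ leaf₃ (j₁≢j₂ ∘ outer-injective) (j₁≢j₃ ∘ outer-injective) (j₂≢j₃ ∘ outer-injective)
      (connected t _ _ j₁∈ j₂∈) (connected t _ _ j₁∈ j₃∈)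
    where
    open InTree t t-proper
    same₂₃ : SamePattern j₂ j₃
    same₂₃ i = trans (sym (same₁₂ i)) (same₁₃ i)
    leaf₁ : Leaf (inE t) (outer j₁)
    leaf₁ = outer-leaf j₁≢j₂ j₁≢j₃ j₂≢j₃ same₁₂ same₁₃ j₁∈ j₂∈ j₃∈
    leaf₂ : Leaf (inE t) (outer j₂)
    leaf₂ = outer-leaf (j₁≢j₂ ∘ sym) j₂≢j₃ j₁≢j₃ (sym ∘ same₁₂) same₂₃ j₂∈ j₁∈ j₃∈
    leaf₃ : Leaf (inE t) (outer j₃)
    leaf₃ = outer-leaf (j₁≢j₃ ∘ sym) (j₂≢j₃ ∘ sym) j₁≢j₂ (sym ∘ same₁₃) (sym ∘ same₂₃) j₃∈ j₁∈ j₂∈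

K-not-two-colourable : ¬ ThreeProperColourable K 2
K-not-two-colourable (c , c-3proper) = no-proper-tree (same-pattern-triple spoke-colour (allFin⁺ 17) ≤-refl)
  where open TwoColouredK c c-3proper


K[Core]-px₃ : IsPx3 K[Core] 2
K[Core]-px₃ = px₃-exact (path-colouring , path-colouring-3proper)
  (one-colour-insufficient _≟ᶜ_ {x = v₀} {v₁} {v₂} (λ ()) (λ ()) (λ ()))

K-px₃ : IsPx3 K 3
K-px₃ = px₃-exact (dominating-set-colourable _≟_ core-dominates (proj₁ K[Core]-px₃)) K-not-two-colourable

theorem3p4 :
    ((n : ℕ) (G : Graph (Fin n)) (D : Fin n → Bool) →
      Connected G → MinDeg≥3 G → Connected3Dominating G D →
      (a b : ℕ) → IsPx3 G a → IsPx3 (Induced G D) b → a ≤ suc b)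
    × (Σ[ n ∈ ℕ ] Σ[ G ∈ Graph (Fin n) ] Σ[ D ∈ (Fin n → Bool) ]
        (Connected G × MinDeg≥3 G × Connected3Dominating G D
         × Σ[ a ∈ ℕ ] Σ[ b ∈ ℕ ] (IsPx3 G a × IsPx3 (Induced G D) b × a ≡ suc b)))
theorem3p4 =
  (λ n G D _ _ (dominating , _) a b → px₃-dominating-set-bound _≟_ dominating) ,
  20 , K , inCore , K-connected , K-min-degree , core-connected-dominating , 3 , 2 , K-px₃ , K[Core]-px₃ , refl
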